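{- Let $k\ge 2$ be an integer and let $G$ be a finite, simple, connected, $k$-colourable graph such that $S_k(G)$ is connected. Let $G^*$ be the graph obtained from $G$ by adding a new vertex $v^*$ and joining it to exactly $j$ vertices of $V(G)$, where $1\le j\le k-2$. Then $S_k(G^*)$ is connected.
   Context: A proper $k$-colouring of a graph $G$ is a map $V(G)\to\{1,\dots,k\}$ giving adjacent vertices different colours. It is called a strong $k$-colouring if all $k$ colours actually appear. The strong $k$-colour graph $S_k(G)$ is the graph whose vertex set is the set of strong $k$-colourings of $G$, two colourings being adjacent if and only if they differ in colour on exactly one vertex of $G$. -}

module Defs where

open import Data.Nat using (ℕ; zero; suc; _≤_; _∸_)
open import Data.Fin using (Fin; zero; suc)
open import Data.Fin.Subset using (Subset; _∈_; ∣_∣)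
open import Data.Product using (Σ; _×_; _,_; ∃; ∃-syntax)
open import Data.Empty using (⊥)
open import Relation.Nullary using (¬_)
open import Relation.Binary.PropositionalEquality using (_≡_; _≢_)

record Graph (n : ℕ) : Set₁ where
  field
    Adj    : Fin n → Fin n → Set
    sym    : ∀ {u v} → Adj u v → Adj v u
    irrefl : ∀ {v} → ¬ Adj v v
open Graph public

data Walk {A : Set} (_≈_ : A → A → Set) (R : A → A → Set) : A → A → Set where
  here : ∀ {x y} → x ≈ y → Walk _≈_ R x y
  step : ∀ {x y z} → R x y → Walk _≈_ R y z → Walk _≈_ R x z

Connected : ∀ {n} → Graph n → Set
Connected {n} G = Fin n × ((u v : Fin n) → Walk _≡_ (Adj G) u v)

Colouring : ℕ → ℕ → Set
Colouring n k = Fin n → Fin k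

Proper : ∀ {n k} → Graph n → Colouring n k → Set
Proper G c = ∀ u v → Adj G u v → c u ≢ c v

Surjective : ∀ {n k} → Colouring n k → Set
Surjective {n} {k} c = (i : Fin k) → ∃[ v ] c v ≡ i

Strong : ∀ {n} → Graph n → (k : ℕ) → Colouring n k → Set
Strong G k c = Proper G c × Surjective c

Colourable : ∀ {n} → Graph n → ℕ → Set
Colourable {n} G k = Σ (Colouring n k) (Proper G)

StrongCol : ∀ {n} → Graph n → ℕ → Set
StrongCol {n} G k = Σ (Colouring n k) (Strong G k)

_≗c_ : ∀ {n k} {G : Graph n} → StrongCol G k → StrongCol G k → Set
_≗c_ {n} (c , _) (d , _) = (v : Fin n) → c v ≡ d v

SAdj : ∀ {n k} {G : Graph n} → StrongCol G k → StrongCol G k → Set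
SAdj {n} (c , _) (d , _) =
  ∃[ v ] (c v ≢ d v × ((w : Fin n) → w ≢ v → c w ≡ d w))

SConnected : ∀ {n} → Graph n → ℕ → Set
SConnected G k =
  StrongCol G k × ((c d : StrongCol G k) → Walk (_≗c_ {G = G}) (SAdj {G = G}) c d)

-- G* : add new vertex v* (= zero) joined exactly to the old vertices in S
-- (old vertex v becomes suc v).
AdjExt : ∀ {n} → Graph n → Subset n → Fin (suc n) → Fin (suc n) → Set
AdjExt G S zero    zero    = ⊥
AdjExt G S zero    (suc v) = v ∈ S
AdjExt G S (suc u) zero    = u ∈ S
AdjExt G S (suc u) (suc v) = Adj G u v

private
  symExt : ∀ {n} (G : Graph n) S u v → AdjExt G S u v → AdjExt G S v u
  symExt G S zero    (suc v) a = a
  symExt G S (suc u) zero    a = a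
  symExt G S (suc u) (suc v) a = sym G {u} {v} a

  irreflExt : ∀ {n} (G : Graph n) S v → ¬ AdjExt G S v v
  irreflExt G S zero    ()
  irreflExt G S (suc v) a = irrefl G {v} a

extend : ∀ {n} → Graph n → Subset n → Graph (suc n)
extend G S = record { Adj = AdjExt G S ; sym = λ {u} {v} → symExt G S u v ; irrefl = λ {v} → irreflExt G S v }

-- Suppose |S| + 2 ≤ k. Call a strong colouring of G* good if its restriction g to G is
-- still strong; the colour x of v* then avoids g(S). Walks in S_k(G) lift to walks
-- between good colourings: before recolouring a vertex z of G, move v* to a colour that
-- avoids g(S) and differs from the new colour of z, which exists as at most |S| + 1
-- colours are excluded.
--
-- If c is not good, the colour a of v* is missing on G and f₀ := c|G uses all other
-- colours. Recolouring to a some vertex y ∉ S that shares its colour gives a good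
-- colouring. To find one, grow a set U of vertices each of which shares its colour in
-- some colouring of this kind reachable from c that, outside U, agrees with f₀ and uses
-- each colour once ("frozen"). While U ⊆ S there is w₁ ∉ U, because |S| < k ≤ n. Take a
-- strong colouring e of G frozen outside U; swapping the colours f₀ w₁ and a in e
-- unfreezes w₁. On a walk in S_k(G) from e to the swapped colouring, the first step that
-- leaves the frozen colourings gives some z ∈ U the colour f₀ w of some w ∉ U, so z and
-- w are non-adjacent, and recolouring z to f₀ w in the colouring witnessing z ∈ U puts
-- w into U.
module Submission where

open import Defs hiding (sym)
open import Data.Nat using (ℕ; zero; suc; _≤_; _<_; _+_; _∸_)
open import Data.Nat.Properties using (≤-trans; <⇒≤; ≤-reflexive; ≤⇒≯; +-monoʳ-≤; m+[n∸m]≡n)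
open import Data.Fin using (Fin; zero; suc; punchOut; _≟_)
open import Data.Fin.Properties using (pigeonhole; punchOut-injective; injective⇒≤; any?; all?; ¬∀⟶∃¬; <⇒≢)
open import Data.Fin.Subset using (Subset; inside; outside; ∣_∣; _∈_; _∉_; _⊆_; _⊂_; _⊃_; _∪_; ⁅_⁆; ⊤; Nonempty)
open import Data.Fin.Subset.Properties using (_∈?_; p⊆p∪q; x∈p∪q⁺; x∈p∪q⁻; x∈⁅x⁆; x∈⁅y⁆⇒x≡y; ∣⊤∣≡n; p⊆q⇒∣p∣≤∣q∣)
open import Data.Fin.Subset.Induction using (⊃-wellFounded)
open import Data.Fin.Permutation using (Permutation; _⟨$⟩ʳ_; _⟨$⟩ˡ_; inverseˡ; inverseʳ; transpose)
open import Data.Vec using ([]; _∷_; tabulate; here; there)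
open import Data.Vec.Properties using (lookup∘tabulate; []=⇒lookup; lookup⇒[]=)
open import Data.Vec.Functional using (updateAt) renaming (_∷_ to _◂_)
open import Data.Vec.Functional.Properties using (updateAt-updates; updateAt-minimal)
open import Data.List using (List; []; _∷_; map; length; lookup)
open import Data.List.Properties using (length-map)
open import Data.List.Relation.Unary.Any as Any using (index)
open import Data.List.Relation.Unary.Any.Properties using (lookup-index)
open import Data.List.Membership.Propositional using () renaming (_∈_ to _∈ₗ_)
open import Data.List.Membership.Propositional.Properties using (∈-map⁺)
import Data.List.Membership.DecPropositional as DecMembership
open import Data.Product using (Σ; _×_; _,_; ∃; proj₁; proj₂; map₂)
open import Data.Sum using (inj₁; inj₂)
open import Data.Empty using (⊥-elim)
open import Level using (0ℓ)
open import Function using (_∘_; const)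
open import Induction.WellFounded using (Acc; acc)
open import Relation.Unary using (Pred; Decidable)
open import Relation.Binary using (IsEquivalence; Symmetric; _Respectsˡ_)
open import Relation.Nullary using (¬_; Dec; yes; no; does)
open import Relation.Nullary.Decidable using (¬?; _×-dec_; decidable-stable; dec-true)
open import Relation.Binary.PropositionalEquality using (_≡_; _≢_; refl; sym; trans; cong; subst; module ≡-Reasoning)

Repeated : ∀ {m} {A : Set} → (Fin m → A) → Fin m → Set
Repeated f y = ∃ λ y′ → y′ ≢ y × f y′ ≡ f y

DifferAt : ∀ {m} {A : Set} → (Fin m → A) → (Fin m → A) → Fin m → Set
DifferAt f g z = f z ≢ g z × (∀ w → w ≢ z → f w ≡ g w)

complete⇒≤length : ∀ {m} (xs : List (Fin m)) → (∀ x → x ∈ₗ xs) → m ≤ length xs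
complete⇒≤length xs complete = injective⇒≤ {f = index ∘ complete} λ {x} {y} eq →
  trans (lookup-index (complete x)) (trans (cong (lookup xs) eq) (sym (lookup-index (complete y))))

elements : ∀ {n} → Subset n → List (Fin n)
elements []            = []
elements (inside  ∷ p) = zero ∷ map suc (elements p)
elements (outside ∷ p) = map suc (elements p)

length-elements : ∀ {n} (p : Subset n) → length (elements p) ≡ ∣ p ∣
length-elements []            = refl
length-elements (inside  ∷ p) = cong suc (trans (length-map suc (elements p)) (length-elements p))
length-elements (outside ∷ p) = trans (length-map suc (elements p)) (length-elements p)

∈-elements : ∀ {n} (p : Subset n) {x} → x ∈ p → x ∈ₗ elements p
∈-elements (inside  ∷ p) here        = Any.here refl
∈-elements (inside  ∷ p) (there x∈p) = Any.there (∈-map⁺ suc (∈-elements p x∈p))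
∈-elements (outside ∷ p) (there x∈p) = ∈-map⁺ suc (∈-elements p x∈p)

∣p∣<m⇒∃-missed : ∀ {n m} (f : Fin n → Fin m) (p : Subset n) → ∣ p ∣ < m →
                 ∃ λ t → ∀ s → s ∈ p → f s ≢ t
∣p∣<m⇒∃-missed {m = m} f p ∣p∣<m = missed (any? (λ t → ¬? (t ∈ₗ? image)))
  where
  open DecMembership _≟_ using () renaming (_∈?_ to _∈ₗ?_)
  image : List (Fin m)
  image = map f (elements p)
  missed : Dec (∃ λ t → ¬ t ∈ₗ image) → ∃ λ t → ∀ s → s ∈ p → f s ≢ t
  missed (yes (t , t∉image)) =
    t , λ s s∈p fs≡t → t∉image (subst (_∈ₗ image) fs≡t (∈-map⁺ f (∈-elements p s∈p)))
  missed (no ¬∃t) = ⊥-elim (≤⇒≯ (≤-trans (complete⇒≤length image complete) length-image) ∣p∣<m)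
    where
    complete : ∀ t → t ∈ₗ image
    complete t = decidable-stable (t ∈ₗ? image) (λ t∉image → ¬∃t (t , t∉image))
    length-image : length image ≤ ∣ p ∣
    length-image = ≤-reflexive (trans (length-map f (elements p)) (length-elements p))

surjective⇒≤ : ∀ {n k} (c : Colouring n k) → Surjective c → k ≤ n
surjective⇒≤ c onto = injective⇒≤ {f = proj₁ ∘ onto} λ {i} {j} eq →
  trans (sym (proj₂ (onto i))) (trans (cong c eq) (proj₂ (onto j)))

missing⇒∃-repeated : ∀ {n k} (f : Fin n → Fin k) (a : Fin k) → (∀ v → f v ≢ a) → k ≤ n →
                     ∃ (Repeated f)
missing⇒∃-repeated {k = suc _} f a f≢a k≤n with pigeonhole k≤n (λ v → punchOut (f≢a v ∘ sym))
... | i , j , i<j , eq = j , i , <⇒≢ i<j , punchOut-injective (f≢a i ∘ sym) (f≢a j ∘ sym) eq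

⟦_⟧ : ∀ {n} {P : Pred (Fin n) 0ℓ} → Decidable P → Subset n
⟦ P? ⟧ = tabulate (does ∘ P?)

∈⟦⟧⁺ : ∀ {n} {P : Pred (Fin n) 0ℓ} (P? : Decidable P) {x} → P x → x ∈ ⟦ P? ⟧
∈⟦⟧⁺ P? {x} px = lookup⇒[]= x _ (trans (lookup∘tabulate _ x) (dec-true (P? x) px))

∈⟦⟧⁻ : ∀ {n} {P : Pred (Fin n) 0ℓ} (P? : Decidable P) {x} → x ∈ ⟦ P? ⟧ → P x
∈⟦⟧⁻ P? {x} x∈ with P? x | trans (sym (lookup∘tabulate (does ∘ P?) x)) ([]=⇒lookup x∈)
... | yes px | _  = px
... | no _   | ()

p⊂p∪⁅x⁆ : ∀ {n} {p : Subset n} {x} → x ∉ p → p ⊂ p ∪ ⁅ x ⁆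
p⊂p∪⁅x⁆ {x = x} x∉p = p⊆p∪q _ , x , x∈p∪q⁺ (inj₂ (x∈⁅x⁆ x)) , x∉p

module WalkProperties {A : Set} {_≈_ R : A → A → Set}
                      (≈-isEquivalence : IsEquivalence _≈_) (R-sym : Symmetric R) (R-resp : R Respectsˡ _≈_) where

  open IsEquivalence ≈-isEquivalence renaming (refl to ≈-refl; sym to ≈-sym; trans to ≈-trans)

  infixr 5 _◅◅_

  ≈-walk : ∀ {x y z} → x ≈ y → Walk _≈_ R y z → Walk _≈_ R x z
  ≈-walk x≈y (here y≈z)  = here (≈-trans x≈y y≈z)
  ≈-walk x≈y (step r w) = step (R-resp (≈-sym x≈y) r) w

  _◅◅_ : ∀ {x y z} → Walk _≈_ R x y → Walk _≈_ R y z → Walk _≈_ R x z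
  here x≈y ◅◅ w′ = ≈-walk x≈y w′
  step r w ◅◅ w′ = step r (w ◅◅ w′)

  single : ∀ {x y} → R x y → Walk _≈_ R x y
  single r = step r (here ≈-refl)

  reverse : ∀ {x y} → Walk _≈_ R x y → Walk _≈_ R y x
  reverse (here x≈y)  = here (≈-sym x≈y)
  reverse (step r w) = reverse w ◅◅ single (R-sym r)

module StrongWalks {m} (H : Graph m) (k : ℕ) where

  ≗c-isEquivalence : IsEquivalence (_≗c_ {k = k} {G = H})
  ≗c-isEquivalence = record
    { refl  = λ _ → refl
    ; sym   = λ c≗d v → sym (c≗d v)
    ; trans = λ c≗d d≗e v → trans (c≗d v) (d≗e v)
    }

  SAdj-sym : Symmetric (SAdj {k = k} {G = H})
  SAdj-sym (v , ne , same) = v , ne ∘ sym , λ w w≢v → sym (same w w≢v)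

  SAdj-respˡ : (SAdj {k = k} {G = H}) Respectsˡ (_≗c_ {k = k} {G = H})
  SAdj-respˡ c≗c′ (v , ne , same) =
    v , ne ∘ trans (c≗c′ v) , λ w w≢v → trans (sym (c≗c′ w)) (same w w≢v)

  open WalkProperties ≗c-isEquivalence (λ {c d} → SAdj-sym {c} {d}) (λ {c d e} → SAdj-respˡ {c} {d} {e}) public

_[_≔_] : ∀ {m k} → Colouring m k → Fin m → Fin k → Colouring m k
f [ z ≔ q ] = updateAt f z (const q)

module Recolouring {m k : ℕ} (f : Colouring m k) (z : Fin m) (q : Fin k) where

  recolour-updates : (f [ z ≔ q ]) z ≡ q
  recolour-updates = updateAt-updates z f

  recolour-minimal : ∀ {v} → v ≢ z → (f [ z ≔ q ]) v ≡ f v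
  recolour-minimal {v} v≢z = updateAt-minimal v z f v≢z

  recolour-differAt : f z ≢ q → DifferAt f (f [ z ≔ q ]) z
  recolour-differAt fz≢q = fz≢q ∘ (λ e → trans e recolour-updates) , λ w w≢z → sym (recolour-minimal w≢z)

  recolour-proper : (H : Graph m) → Proper H f → (∀ u → Adj H z u → f u ≢ q) → Proper H (f [ z ≔ q ])
  recolour-proper H proper q-free u v adj eq with u ≟ z | v ≟ z
  ... | yes refl | yes refl = irrefl H adj
  ... | yes refl | no v≢z   = q-free v adj (trans (sym (recolour-minimal v≢z)) (trans (sym eq) recolour-updates))
  ... | no u≢z   | yes refl = q-free u (Graph.sym H adj) (trans (sym (recolour-minimal u≢z)) (trans eq recolour-updates))
  ... | no u≢z   | no v≢z   = proper u v adj (trans (sym (recolour-minimal u≢z)) (trans eq (recolour-minimal v≢z)))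

  recolour-covers : ∀ {i} → Repeated f z → ∃ (λ v → f v ≡ i) → ∃ λ v → (f [ z ≔ q ]) v ≡ i
  recolour-covers (z′ , z′≢z , same) (v , fv≡i) with v ≟ z
  ... | yes refl = z′ , trans (recolour-minimal z′≢z) (trans same fv≡i)
  ... | no v≢z   = v , trans (recolour-minimal v≢z) fv≡i

permute-strong : ∀ {m k} {H : Graph m} {c : Colouring m k} (π : Permutation k k) →
                 Strong H k c → Strong H k ((π ⟨$⟩ʳ_) ∘ c)
permute-strong {c = c} π (proper , onto) = (λ u v adj eq → proper u v adj (π-injective eq)) , onto′
  where
  π-injective : ∀ {i j} → π ⟨$⟩ʳ i ≡ π ⟨$⟩ʳ j → i ≡ j
  π-injective eq = trans (sym (inverseˡ π)) (trans (cong (π ⟨$⟩ˡ_) eq) (inverseˡ π))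
  onto′ : Surjective ((π ⟨$⟩ʳ_) ∘ c)
  onto′ i = proj₁ (onto (π ⟨$⟩ˡ i)) , trans (cong (π ⟨$⟩ʳ_) (proj₂ (onto (π ⟨$⟩ˡ i)))) (inverseʳ π)

transpose-sends : ∀ {k} (i j : Fin k) → transpose i j ⟨$⟩ʳ i ≡ j
transpose-sends i j rewrite dec-true (i ≟ i) refl = refl

module Extension {n k : ℕ} (G : Graph n) (S : Subset n)
                 (Sₖ-connected : SConnected G k) (S-small : 2 + ∣ S ∣ ≤ k) where

  G* : Graph (suc n)
  G* = extend G S

  open StrongWalks G* k using (_◅◅_; single; reverse)

  Walkᴳ : StrongCol G k → StrongCol G k → Set
  Walkᴳ = Walk (_≗c_ {G = G}) (SAdj {G = G})

  Walk* : StrongCol G* k → StrongCol G* k → Set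
  Walk* = Walk (_≗c_ {G = G*}) (SAdj {G = G*})

  Avoids : Colouring n k → Fin k → Set
  Avoids f x = ∀ s → s ∈ S → f s ≢ x

  apex-proper : ∀ {f x} → Proper G f → Avoids f x → Proper G* (x ◂ f)
  apex-proper proper avoids zero    (suc v) v∈S = avoids v v∈S ∘ sym
  apex-proper proper avoids (suc u) zero    u∈S = avoids u u∈S
  apex-proper proper avoids (suc u) (suc v) adj = proper u v adj

  ◂-differAt : ∀ {x} {f f′ : Colouring n k} {z} → DifferAt f f′ z → DifferAt (x ◂ f) (x ◂ f′) (suc z)
  ◂-differAt (ne , same) = ne , λ { zero _ → refl ; (suc w) w≢z → same w (w≢z ∘ cong suc) }

  lift : (g : StrongCol G k) (x : Fin k) → Avoids (proj₁ g) x → StrongCol G* k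
  lift (f , proper , onto) x avoids =
    x ◂ f , apex-proper proper avoids , λ i → suc (proj₁ (onto i)) , proj₂ (onto i)

  ∃-avoided : (f : Colouring n k) (q : Fin k) → ∃ λ t → t ≢ q × Avoids f t
  ∃-avoided f q with ∣p∣<m⇒∃-missed (q ◂ f) (inside ∷ S) S-small
  ... | t , missed = t , (λ t≡q → missed zero here (sym t≡q)) , λ s s∈S → missed (suc s) (there s∈S)

  apex-walk : ∀ {g h : StrongCol G k} {x y} (avoids-x : Avoids (proj₁ g) x) (avoids-y : Avoids (proj₁ h) y) →
              _≗c_ {G = G} g h → Walk* (lift g x avoids-x) (lift h y avoids-y)
  apex-walk {x = x} {y} _ _ g≗h with x ≟ y
  ... | yes refl = here λ { zero → refl ; (suc v) → g≗h v }
  ... | no x≢y   = single (zero , x≢y , λ { zero 0≢0 → ⊥-elim (0≢0 refl) ; (suc v) _ → g≗h v })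

  lift-walk : ∀ {g h : StrongCol G k} {x y} (avoids-x : Avoids (proj₁ g) x) (avoids-y : Avoids (proj₁ h) y) →
              Walkᴳ g h → Walk* (lift g x avoids-x) (lift h y avoids-y)
  lift-walk {g} {h} avoids-x avoids-y (here g≗h) = apex-walk {g} {h} avoids-x avoids-y g≗h
  lift-walk {g} avoids-x avoids-y (step {y = g′} (z , differ) w) with ∃-avoided (proj₁ g) (proj₁ g′ z)
  ... | t , t≢g′z , avoids-t =
    apex-walk {g} {g} avoids-x avoids-t (λ _ → refl) ◅◅
    step (suc z , ◂-differAt differ) (lift-walk avoids-t′ avoids-y w)
    where
    avoids-t′ : Avoids (proj₁ g′) t
    avoids-t′ s s∈S with s ≟ z
    ... | yes refl = t≢g′z ∘ sym
    ... | no s≢z   = avoids-t s s∈S ∘ trans (proj₂ differ s s≢z)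

  k≤n : k ≤ n
  k≤n = surjective⇒≤ (proj₁ (proj₁ Sₖ-connected)) (proj₂ (proj₂ (proj₁ Sₖ-connected)))

  p⊆S⇒∃∉p : ∀ {U} → U ⊆ S → ∃ λ w → w ∉ U
  p⊆S⇒∃∉p {U} U⊆S = decidable-stable (any? λ w → ¬? (w ∈? U)) λ ¬∃w →
    ≤⇒≯ (≤-trans k≤n (n≤∣S∣ ¬∃w)) (<⇒≤ S-small)
    where
    n≤∣S∣ : ¬ (∃ λ w → w ∉ U) → n ≤ ∣ S ∣
    n≤∣S∣ ¬∃w = subst (_≤ ∣ S ∣) (∣⊤∣≡n n)
      (p⊆q⇒∣p∣≤∣q∣ {p = ⊤} λ {y} _ → U⊆S (decidable-stable (y ∈? U) λ y∉U → ¬∃w (y , y∉U)))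

  record AllBut (a : Fin k) : Set where
    field
      colouring : Colouring n k
      proper    : Proper G colouring
      avoids    : ∀ v → colouring v ≢ a
      covers    : ∀ i → i ≢ a → ∃ λ v → colouring v ≡ i

  open AllBut

  withApex : ∀ {a} → AllBut a → StrongCol G* k
  withApex {a} B = a ◂ colouring B , apex-proper (proper B) (λ s _ → avoids B s) , onto
    where
    onto : Surjective (a ◂ colouring B)
    onto i with i ≟ a
    ... | yes i≡a = zero , sym i≡a
    ... | no i≢a  = suc (proj₁ (covers B i i≢a)) , proj₂ (covers B i i≢a)

  fill-missing : ∀ {a} (B : AllBut a) {y} → Repeated (colouring B) y → StrongCol G k
  fill-missing {a} B {y} repeated = colouring B [ y ≔ a ] , recolour-proper G (proper B) (λ u _ → avoids B u) , onto
    where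
    open Recolouring (colouring B) y a
    onto : Surjective (colouring B [ y ≔ a ])
    onto i with i ≟ a
    ... | yes refl = y , recolour-updates
    ... | no i≢a   = recolour-covers repeated (covers B i i≢a)

  ReachesGood : StrongCol G* k → Set
  ReachesGood c = Σ (StrongCol G k) λ g → Σ (Fin k) λ x → Σ (Avoids (proj₁ g) x) λ avoids-x →
                    Walk* c (lift g x avoids-x)

  prepend : ∀ {c d} → Walk* c d → ReachesGood d → ReachesGood c
  prepend c⇝d (g , x , avoids-x , d⇝) = g , x , avoids-x , c⇝d ◅◅ d⇝

  escape : ∀ {a} (B : AllBut a) {y} (repeated : Repeated (colouring B) y) → y ∉ S → ReachesGood (withApex B)
  escape {a} B {y} repeated y∉S =
    fill-missing B repeated , a , avoids-a , single (suc y , ◂-differAt (recolour-differAt (avoids B y)))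
    where
    open Recolouring (colouring B) y a
    avoids-a : Avoids (colouring B [ y ≔ a ]) a
    avoids-a s s∈S with s ≟ y
    ... | yes refl = ⊥-elim (y∉S s∈S)
    ... | no s≢y   = avoids B s ∘ trans (sym (recolour-minimal s≢y))

  module Missing {a : Fin k} (B₀ : AllBut a) where

    f₀ : Colouring n k
    f₀ = colouring B₀

    Frozen : Subset n → Colouring n k → Set
    Frozen U g = ∀ w → w ∉ U → g w ≡ f₀ w × (∀ v → g v ≡ f₀ w → v ≡ w)

    frozen-anti : ∀ {U U′ g} → U ⊆ U′ → Frozen U g → Frozen U′ g
    frozen-anti U⊆U′ frozen w w∉U′ = frozen w (w∉U′ ∘ U⊆U′)

    frozen-resp : ∀ {U g h} → (∀ v → g v ≡ h v) → Frozen U g → Frozen U h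
    frozen-resp g≗h frozen w w∉U =
      trans (sym (g≗h w)) (proj₁ (frozen w w∉U)) ,
      λ v hv≡f₀w → proj₂ (frozen w w∉U) v (trans (g≗h v) hv≡f₀w)

    frozen-update : ∀ {U g h z} → Frozen U g → z ∈ U → (∀ w → w ∉ U → h z ≢ f₀ w) →
                    (∀ v → v ≢ z → g v ≡ h v) → Frozen U h
    frozen-update {U} {g} {h} {z} frozen z∈U fresh same w w∉U =
      trans (sym (same w w≢z)) (proj₁ (frozen w w∉U)) , unique
      where
      w≢z : w ≢ z
      w≢z w≡z = w∉U (subst (_∈ U) (sym w≡z) z∈U)
      unique : ∀ v → h v ≡ f₀ w → v ≡ w
      unique v hv≡f₀w with v ≟ z
      ... | yes refl = ⊥-elim (fresh w w∉U hv≡f₀w)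
      ... | no v≢z   = proj₂ (frozen w w∉U) v (trans (same v v≢z) hv≡f₀w)

    -- Were z ∉ U, its old colour f₀ z would have to survive at another vertex, but z is its only bearer.
    changed∈ : ∀ {U} {g h : StrongCol G k} {z} →
               Frozen U (proj₁ g) → DifferAt (proj₁ g) (proj₁ h) z → z ∈ U
    changed∈ {U} {g} {h} {z} frozen (ne , same) = decidable-stable (z ∈? U) λ z∉U →
      let (v , hv≡gz) = proj₂ (proj₂ h) (proj₁ g z)
          v≢z : v ≢ z
          v≢z v≡z = ne (sym (trans (cong (proj₁ h) (sym v≡z)) hv≡gz))
      in v≢z (proj₂ (frozen z z∉U) v (trans (same v v≢z) (trans hv≡gz (proj₁ (frozen z z∉U)))))

    record Crossing (U : Subset n) : Set where
      field
        inner       : Fin n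
        outer       : Fin n
        inner∈      : inner ∈ U
        outer∉      : outer ∉ U
        nonadjacent : ¬ Adj G inner outer

    crossing : ∀ {U} {g h : StrongCol G k} →
               Walkᴳ g h → Frozen U (proj₁ g) → ¬ Frozen U (proj₁ h) → Crossing U
    crossing (here g≗h) frozen ¬frozen = ⊥-elim (¬frozen (frozen-resp g≗h frozen))
    crossing {U} {g} (step {y = g′} (z , differ) w) frozen ¬frozen =
      decide (any? λ w → ¬? (w ∈? U) ×-dec (proj₁ g′ z ≟ f₀ w))
      where
      z∈U : z ∈ U
      z∈U = changed∈ {g = g} {h = g′} frozen differ
      decide : Dec (∃ λ w → w ∉ U × proj₁ g′ z ≡ f₀ w) → Crossing U
      decide (yes (w , w∉U , g′z≡f₀w)) = record
        { inner = z ; outer = w ; inner∈ = z∈U ; outer∉ = w∉U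
        ; nonadjacent = λ adj → proj₁ (proj₂ g′) z w adj (trans g′z≡f₀w (sym g′w≡f₀w)) }
        where
        g′w≡f₀w : proj₁ g′ w ≡ f₀ w
        g′w≡f₀w = trans (sym (proj₂ differ w λ w≡z → w∉U (subst (_∈ U) (sym w≡z) z∈U)))
                        (proj₁ (frozen w w∉U))
      decide (no ¬∃) =
        crossing w (frozen-update frozen z∈U (λ w w∉U eq → ¬∃ (w , w∉U , eq)) (proj₂ differ)) ¬frozen

    record Reachable (U : Subset n) (y : Fin n) : Set where
      field
        via      : AllBut a
        walk     : Walk* (withApex B₀) (withApex via)
        repeated : Repeated (colouring via) y
        frozen   : Frozen U (colouring via)

    reachable-anti : ∀ {U U′ y} → U ⊆ U′ → Reachable U y → Reachable U′ y
    reachable-anti U⊆U′ R =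
      record { via = via ; walk = walk ; repeated = repeated ; frozen = frozen-anti U⊆U′ frozen }
      where open Reachable R

    record Progress (U : Subset n) : Set where
      field
        nonempty  : Nonempty U
        reachable : ∀ {y} → y ∈ U → Reachable U y

    open Progress
    open Crossing

    reach-outer : ∀ {U} → Progress U → (c : Crossing U) → Reachable (U ∪ ⁅ outer c ⁆) (outer c)
    reach-outer {U} progress
      record { inner = z ; outer = w ; inner∈ = z∈U ; outer∉ = w∉U ; nonadjacent = z≁w } = record
      { via      = B′
      ; walk     = walk ◅◅ single (suc z , ◂-differAt (recolour-differAt fz≢f₀w))
      ; repeated = z , z≢w , trans recolour-updates (sym (trans (recolour-minimal (z≢w ∘ sym)) fw≡f₀w))
      ; frozen   = frozen-update (frozen-anti U⊆U′ frozen) (U⊆U′ z∈U) fresh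
                                 (λ v v≢z → sym (recolour-minimal v≢z))
      }
      where
      open Reachable (reachable progress z∈U)
      U′ = U ∪ ⁅ w ⁆
      U⊆U′ : U ⊆ U′
      U⊆U′ = p⊆p∪q ⁅ w ⁆
      f = colouring via
      open Recolouring f z (f₀ w)
      z≢w : z ≢ w
      z≢w z≡w = w∉U (subst (_∈ U) z≡w z∈U)
      fw≡f₀w : f w ≡ f₀ w
      fw≡f₀w = proj₁ (frozen w w∉U)
      only-w : ∀ v → f v ≡ f₀ w → v ≡ w
      only-w = proj₂ (frozen w w∉U)
      fz≢f₀w : f z ≢ f₀ w
      fz≢f₀w = z≢w ∘ only-w z
      B′ : AllBut a
      B′ = record
        { colouring = f [ z ≔ f₀ w ]
        ; proper    = recolour-proper G (proper via)
                        λ u adj fu≡f₀w → z≁w (subst (Adj G z) (only-w u fu≡f₀w) adj)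
        ; avoids    = avoids′
        ; covers    = λ i i≢a → recolour-covers repeated (covers via i i≢a)
        }
        where
        avoids′ : ∀ v → (f [ z ≔ f₀ w ]) v ≢ a
        avoids′ v with v ≟ z
        ... | yes refl = avoids B₀ w ∘ trans (sym recolour-updates)
        ... | no v≢z   = avoids via v ∘ trans (sym (recolour-minimal v≢z))
      fresh : ∀ w′ → w′ ∉ U′ → (f [ z ≔ f₀ w ]) z ≢ f₀ w′
      fresh w′ w′∉U′ eq = w′∉U′ (subst (_∈ U′) w≡w′ (x∈p∪q⁺ (inj₂ (x∈⁅x⁆ w))))
        where
        w≡w′ : w ≡ w′
        w≡w′ = proj₂ (frozen w′ (w′∉U′ ∘ U⊆U′)) w (trans fw≡f₀w (trans (sym recolour-updates) eq))

    grow : ∀ {U} → Progress U → (c : Crossing U) → Progress (U ∪ ⁅ outer c ⁆)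
    grow {U} progress c = record
      { nonempty  = outer c , x∈p∪q⁺ (inj₂ (x∈⁅x⁆ (outer c)))
      ; reachable = reachable′
      }
      where
      reachable′ : ∀ {y} → y ∈ U ∪ ⁅ outer c ⁆ → Reachable (U ∪ ⁅ outer c ⁆) y
      reachable′ y∈U′ with x∈p∪q⁻ U ⁅ outer c ⁆ y∈U′
      ... | inj₁ y∈U = reachable-anti (p⊆p∪q ⁅ outer c ⁆) (reachable progress y∈U)
      ... | inj₂ y∈⁅w⁆ rewrite x∈⁅y⁆⇒x≡y (outer c) y∈⁅w⁆ = reach-outer progress c

    crossing-from : ∀ {U w₁} → Progress U → w₁ ∉ U → Crossing U
    crossing-from {U} {w₁} progress w₁∉U = crossing (proj₂ Sₖ-connected e e′) frozen-e ¬frozen-e′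
      where
      y = proj₁ (nonempty progress)
      y∈U = proj₂ (nonempty progress)
      open Reachable (reachable progress y∈U)
      open Recolouring (colouring via) y a
      e e′ : StrongCol G k
      e = fill-missing via repeated
      π = transpose (f₀ w₁) a
      e′ = (π ⟨$⟩ʳ_) ∘ proj₁ e , permute-strong {H = G} π (proj₂ e)
      frozen-e : Frozen U (proj₁ e)
      frozen-e = frozen-update frozen y∈U (λ w _ a≡f₀w → avoids B₀ w (trans (sym a≡f₀w) recolour-updates))
                   (λ v v≢y → sym (recolour-minimal v≢y))
      ¬frozen-e′ : ¬ Frozen U (proj₁ e′)
      ¬frozen-e′ frozen-e′ = avoids B₀ w₁ (sym (begin
        a                       ≡⟨ sym (transpose-sends (f₀ w₁) a) ⟩
        π ⟨$⟩ʳ f₀ w₁            ≡⟨ cong (π ⟨$⟩ʳ_) (sym (proj₁ (frozen-e w₁ w₁∉U))) ⟩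
        proj₁ e′ w₁             ≡⟨ proj₁ (frozen-e′ w₁ w₁∉U) ⟩
        f₀ w₁                   ∎))
        where open ≡-Reasoning

    reaches-good-from : ∀ {U} → Acc _⊃_ U → Progress U → ReachesGood (withApex B₀)
    reaches-good-from {U} (acc smaller) progress with any? (λ y → (y ∈? U) ×-dec ¬? (y ∈? S))
    ... | yes (y , y∈U , y∉S) = prepend walk (escape via repeated y∉S)
      where open Reachable (reachable progress y∈U)
    ... | no ¬escape = reaches-good-from (smaller (p⊂p∪⁅x⁆ (outer∉ c))) (grow progress c)
      where
      U⊆S : U ⊆ S
      U⊆S {y} y∈U = decidable-stable (y ∈? S) λ y∉S → ¬escape (y , y∈U , y∉S)
      c = crossing-from progress (proj₂ (p⊆S⇒∃∉p U⊆S))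

    repeated? : Decidable (Repeated f₀)
    repeated? y = any? λ y′ → ¬? (y′ ≟ y) ×-dec (f₀ y′ ≟ f₀ y)

    progress₀ : Progress ⟦ repeated? ⟧
    progress₀ = record
      { nonempty  = map₂ (∈⟦⟧⁺ repeated?) (missing⇒∃-repeated f₀ a (avoids B₀) k≤n)
      ; reachable = λ y∈U₀ → record
        { via = B₀ ; walk = here (λ _ → refl) ; repeated = ∈⟦⟧⁻ repeated? y∈U₀ ; frozen = frozen₀ }
      }
      where
      frozen₀ : Frozen ⟦ repeated? ⟧ f₀
      frozen₀ w w∉U₀ = refl , λ v f₀v≡f₀w →
        decidable-stable (v ≟ w) λ v≢w → w∉U₀ (∈⟦⟧⁺ repeated? (v , v≢w , f₀v≡f₀w))

    reaches-good : ReachesGood (withApex B₀)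
    reaches-good = reaches-good-from (⊃-wellFounded _) progress₀

  reaches-good : (c : StrongCol G* k) → ReachesGood c
  reaches-good (c , proper* , onto*) with all? (λ i → any? (λ v → c (suc v) ≟ i))
  ... | yes onto = (c ∘ suc , (λ u v → proper* (suc u) (suc v)) , onto) , c zero ,
                   (λ s s∈S → proper* (suc s) zero s∈S) , here (λ { zero → refl ; (suc v) → refl })
  ... | no ¬onto with ¬∀⟶∃¬ k _ (λ i → any? (λ v → c (suc v) ≟ i)) ¬onto
  ...   | a , a-missed = prepend (here c≗withApex) (Missing.reaches-good B₀)
    where
    c₀≡a : c zero ≡ a
    c₀≡a with onto* a
    ... | zero  , c₀≡a = c₀≡a
    ... | suc v , cv≡a = ⊥-elim (a-missed (v , cv≡a))
    B₀ : AllBut a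
    B₀ = record
      { colouring = c ∘ suc
      ; proper    = λ u v → proper* (suc u) (suc v)
      ; avoids    = λ v cv≡a → a-missed (v , cv≡a)
      ; covers    = covers₀
      }
      where
      covers₀ : ∀ i → i ≢ a → ∃ λ v → c (suc v) ≡ i
      covers₀ i i≢a with onto* i
      ... | zero  , c₀≡i = ⊥-elim (i≢a (trans (sym c₀≡i) c₀≡a))
      ... | suc v , cv≡i = v , cv≡i
    c≗withApex : ∀ v → c v ≡ proj₁ (withApex B₀) v
    c≗withApex zero    = c₀≡a
    c≗withApex (suc v) = refl

  extend-connected : SConnected G* k
  extend-connected = lift g₀ (proj₁ t) (proj₂ t) , λ c d → connect (reaches-good c) (reaches-good d)
    where
    g₀ = proj₁ Sₖ-connected
    t = ∣p∣<m⇒∃-missed (proj₁ g₀) S (<⇒≤ S-small)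
    connect : ∀ {c d} → ReachesGood c → ReachesGood d → Walk* c d
    connect (g , x , avoids-x , c⇝g) (h , y , avoids-y , d⇝h) =
      c⇝g ◅◅ lift-walk {g} {h} avoids-x avoids-y (proj₂ Sₖ-connected g h) ◅◅ reverse d⇝h

theorem2p2 : (k n : ℕ) → 2 ≤ k → (G : Graph n) → Connected G → Colourable G k →
    SConnected G k → (j : ℕ) → 1 ≤ j → j ≤ k ∸ 2 → (S : Subset n) → ∣ S ∣ ≡ j →
    SConnected (extend G S) k
theorem2p2 k n 2≤k G _ _ Sₖ-connected j _ j≤k∸2 S ∣S∣≡j = Extension.extend-connected G S Sₖ-connected S-small
  where
  S-small : 2 + ∣ S ∣ ≤ k
  S-small = subst (λ i → 2 + i ≤ k) (sym ∣S∣≡j)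
                  (subst (2 + j ≤_) (m+[n∸m]≡n 2≤k) (+-monoʳ-≤ 2 j≤k∸2))
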